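{- Suppose the input graph $G$ is a cactus graph, revealed in an admissible order $v_1,\dots,v_n$. Then at most one cross edge is incident on any vertex $v_i$. In particular, every vertex $v_i$ has at most $2$ neighbours among $v_1,\dots,v_{i-1}$.
   Context: A cactus graph is a connected graph in which every edge lies on at most one cycle. Online input model: a finite connected simple undirected graph $G$ is revealed in an order $v_1,\dots,v_n$ such that for each $i$ the subgraph induced on $R_i=\{v_1,\dots,v_i\}$ is connected; when $v_i$ is revealed, its whole closed neighbourhood is revealed. $V_i=N[R_i]$ is the set of vertices visible at time $i$, with $V_0=\emptyset$. If $v_j\in V_i\setminus V_{i-1}$ and $j\neq i$, then $v_j$ is a child of $v_i$ and $v_i$ is the parent of $v_j$ (the parent of a vertex is the first revealed vertex among its neighbours); an edge between a vertex and its parent is a tree edge. Any edge $\{u,v\}$ with neither endpoint the parent of the other is a cross edge. -}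

module Defs where

open import Data.Nat as ℕ using (ℕ; zero; suc)
open import Data.Nat.DivMod using (_mod_)
open import Data.Fin using (Fin; toℕ; _<_; _≤_)
open import Data.Product using (Σ; ∃; _×_; _,_)
open import Data.Sum using (_⊎_)
open import Relation.Nullary using (¬_; Dec)
open import Relation.Binary.PropositionalEquality using (_≡_)
open import Function.Definitions using (Injective)
open import Function.Bundles using (_⇔_)

-- A finite simple undirected graph on vertex set Fin n.
-- Vertex (index) i : Fin n is v_{i+1} in the paper (0-based reveal order).
record Graph (n : ℕ) : Set₁ where
  field
    Adj     : Fin n → Fin n → Set
    adj?    : ∀ u v → Dec (Adj u v)
    sym     : ∀ {u v} → Adj u v → Adj v u
    irrefl  : ∀ {u} → ¬ Adj u u

module _ {n : ℕ} (G : Graph n) where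
  open Graph G

  data WalkIn (P : Fin n → Set) : Fin n → Fin n → Set where
    here : ∀ {u} → WalkIn P u u
    step : ∀ {u w v} → Adj u w → P w → WalkIn P w v → WalkIn P u v

  ConnectedOn : (Fin n → Set) → Set
  ConnectedOn P = ∀ u v → P u → P v → WalkIn P u v

  Connected : Set
  Connected = ConnectedOn (λ _ → Data.Unit.⊤)
    where import Data.Unit

  -- Admissible order: the identity order 0,1,…,n-1; every prefix
  -- R_i = {v_1,…,v_i} induces a connected subgraph.
  Admissible : Set
  Admissible = ∀ (i : Fin n) → ConnectedOn (λ j → j ≤ i)

  record Cycle : Set where
    field
      k      : ℕ
      vert   : Fin (suc (suc (suc k))) → Fin n
      inj    : Injective _≡_ _≡_ vert
    next : Fin (suc (suc (suc k))) → Fin (suc (suc (suc k)))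
    next i = suc (toℕ i) mod (suc (suc (suc k)))
    field
      closed : ∀ i → Adj (vert i) (vert (next i))

  EdgeOn : Fin n → Fin n → Cycle → Set
  EdgeOn u v C = ∃ λ i → (vert i ≡ u × vert (next i) ≡ v)
                       ⊎ (vert i ≡ v × vert (next i) ≡ u)
    where open Cycle C

  SameCycle : Cycle → Cycle → Set
  SameCycle C D = ∀ x y → EdgeOn x y C ⇔ EdgeOn x y D

  Cactus : Set
  Cactus = Connected ×
    (∀ u v → Adj u v → ∀ C D → EdgeOn u v C → EdgeOn u v D → SameCycle C D)

  Parent : Fin n → Fin n → Set
  Parent p j = p < j × Adj p j × (∀ q → q < p → ¬ Adj q j)

  CrossEdge : Fin n → Fin n → Set
  CrossEdge u v = Adj u v × ¬ Parent u v × ¬ Parent v u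

-- Let i have a cross edge to j. Then i is not the first vertex, so it has a
-- parent p, and j ≠ p. Since the prefix revealed before i is connected, j is
-- joined to p by a path avoiding i: directly inside that prefix if j < i, and
-- through the parent of j (revealed before i, as i is not the parent of j) if
-- i < j. Closing this path through i gives a cycle whose only edges at i are
-- ij and ip. A second cross edge ik yields likewise a cycle through ip, and in
-- a cactus these two cycles coincide, so k = j. Finally every earlier
-- neighbour of i is either its parent or the other end of a cross edge.
module Submission where

open import Defs
open import Data.Nat using (ℕ; suc; z≤n; s≤s; z<s; s<s)
import Data.Nat.Properties as ℕ
open import Data.Nat.DivMod using (_mod_; _%_; n%n≡0; m<n⇒m%n≡m)
open import Data.Fin using (Fin; zero; suc; toℕ; fromℕ; inject₁; _<_; _≤_; _≟_)
open import Data.Fin.Properties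
  using (toℕ-injective; toℕ-fromℕ; toℕ-fromℕ<; toℕ-inject₁; inject₁ℕ<; ≤-total; <-cmp; ≤∧≢⇒<; <⇒≢)
open import Data.Fin.Relation.Unary.Top using (view; ‵fromℕ; ‵inj₁)
open import Data.Vec using (Vec; []; _∷_; lookup)
open import Data.Vec.Relation.Unary.All using (All; []; _∷_)
import Data.Vec.Relation.Unary.All as All
open import Data.Vec.Relation.Unary.AllPairs using ([]; _∷_)
open import Data.Vec.Relation.Unary.Unique.Propositional using (Unique)
open import Data.Vec.Relation.Unary.Unique.Propositional.Properties using (lookup-injective)
open import Data.Product using (∃; _×_; _,_)
open import Data.Sum using (_⊎_; inj₁; inj₂; map₂)
open import Relation.Nullary using (¬_; Dec; yes; no; contradiction)
open import Relation.Binary using (tri<; tri≈; tri>)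
open import Relation.Binary.PropositionalEquality
  using (_≡_; _≢_; refl; sym; trans; cong; subst; ≢-sym; module ≡-Reasoning)
open import Function.Bundles using (Equivalence)

suc-mod-fromℕ : ∀ m → suc (toℕ (fromℕ m)) mod suc m ≡ zero
suc-mod-fromℕ m = toℕ-injective (begin
  toℕ (suc (toℕ (fromℕ m)) mod suc m)  ≡⟨ toℕ-fromℕ< _ ⟩
  suc (toℕ (fromℕ m)) % suc m          ≡⟨ cong (λ x → suc x % suc m) (toℕ-fromℕ m) ⟩
  suc m % suc m                        ≡⟨ n%n≡0 (suc m) ⟩
  0                                    ∎)
  where open ≡-Reasoning

suc-mod-inject₁ : ∀ {m} (a : Fin m) → suc (toℕ (inject₁ a)) mod suc m ≡ suc a
suc-mod-inject₁ {m} a = toℕ-injective (begin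
  toℕ (suc (toℕ (inject₁ a)) mod suc m)  ≡⟨ toℕ-fromℕ< _ ⟩
  suc (toℕ (inject₁ a)) % suc m          ≡⟨ m<n⇒m%n≡m (s<s (inject₁ℕ< a)) ⟩
  suc (toℕ (inject₁ a))                  ≡⟨ cong suc (toℕ-inject₁ a) ⟩
  suc (toℕ a)                            ∎)
  where open ≡-Reasoning

least-witness : ∀ {n} {P : Fin n → Set} → (∀ x → Dec (P x)) → ∀ x → P x →
  ∃ λ y → P y × y ≤ x × (∀ z → z < y → ¬ P z)
least-witness {suc n} P? x px with P? zero
... | yes p₀ = zero , p₀ , z≤n , λ _ ()
least-witness {suc n} P? zero    px | no ¬p₀ = contradiction px ¬p₀
least-witness {suc n} P? (suc x) px | no ¬p₀ with least-witness (λ z → P? (suc z)) x px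
... | y , py , y≤x , below-y = suc y , py , s≤s y≤x , least
  where
  least : ∀ z → z < suc y → ¬ _
  least zero    _         = ¬p₀
  least (suc z) (s<s z<y) = below-y z z<y

at-most-two : ∀ {A : Set} {P Q : A → Set} →
  (∀ {x y} → P x → P y → x ≡ y) → (∀ {x y} → Q x → Q y → x ≡ y) →
  ∀ {j k l} → P j ⊎ Q j → P k ⊎ Q k → P l ⊎ Q l → j ≡ k ⊎ j ≡ l ⊎ k ≡ l
at-most-two P! Q! (inj₁ pj) (inj₁ pk) _         = inj₁ (P! pj pk)
at-most-two P! Q! (inj₂ qj) (inj₂ qk) _         = inj₁ (Q! qj qk)
at-most-two P! Q! (inj₁ pj) (inj₂ _)  (inj₁ pl) = inj₂ (inj₁ (P! pj pl))
at-most-two P! Q! (inj₂ qj) (inj₁ _)  (inj₂ ql) = inj₂ (inj₁ (Q! qj ql))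
at-most-two P! Q! (inj₁ _)  (inj₂ qk) (inj₂ ql) = inj₂ (inj₂ (Q! qk ql))
at-most-two P! Q! (inj₂ _)  (inj₁ pk) (inj₁ pl) = inj₂ (inj₂ (P! pk pl))

module _ {n : ℕ} (G : Graph n) where
  open Graph G renaming (sym to adj-sym)

  walk-mono : ∀ {P Q : Fin n → Set} → (∀ {x} → P x → Q x) →
    ∀ {a b} → WalkIn G P a b → WalkIn G Q a b
  walk-mono P⊆Q here           = here
  walk-mono P⊆Q (step adj p w) = step adj (P⊆Q p) (walk-mono P⊆Q w)

  -- Path a xs b: a ∷ xs lists the vertices of a path from a to b in order.
  data Path : Fin n → ∀ {m} → Vec (Fin n) m → Fin n → Set where
    []  : ∀ {a} → Path a [] a
    _∷_ : ∀ {a w b m} {xs : Vec (Fin n) m} → Adj a w → Path w xs b → Path a (w ∷ xs) b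

  path-adjacent : ∀ {a b m} {xs : Vec (Fin n) m} → Path a xs b →
    ∀ t → Adj (lookup (a ∷ xs) (inject₁ t)) (lookup (a ∷ xs) (suc t))
  path-adjacent (adj ∷ _)  zero    = adj
  path-adjacent (_ ∷ path) (suc t) = path-adjacent path t

  path-last : ∀ {a b m} {xs : Vec (Fin n) m} → Path a xs b → lookup (a ∷ xs) (fromℕ m) ≡ b
  path-last []         = refl
  path-last (_ ∷ path) = path-last path

  record SimplePathIn (P : Fin n → Set) (a b : Fin n) : Set where
    field
      {length} : ℕ
      vertices : Vec (Fin n) length
      path     : Path a vertices b
      unique   : Unique (a ∷ vertices)
      inside   : All P vertices
  open SimplePathIn

  shortcut : ∀ {P a w b m} {xs : Vec (Fin n) m} →
    Path w xs b → Unique (w ∷ xs) → All P (w ∷ xs) →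
    All (a ≢_) (w ∷ xs) ⊎ SimplePathIn P a b
  shortcut {a = a} {w} path (w∉xs ∷ u) (_ ∷ ps) with a ≟ w
  ... | yes refl = inj₂ (record { path = path ; unique = w∉xs ∷ u ; inside = ps })
  shortcut [] _ _ | no a≢w = inj₁ (a≢w ∷ [])
  shortcut (_ ∷ path) (_ ∷ u) (_ ∷ ps) | no a≢w with shortcut path u ps
  ... | inj₁ a∉xs = inj₁ (a≢w ∷ a∉xs)
  ... | inj₂ s    = inj₂ s

  walk⇒simplePath : ∀ {P a b} → WalkIn G P a b → SimplePathIn P a b
  walk⇒simplePath here = record { vertices = [] ; path = [] ; unique = [] ∷ [] ; inside = [] }
  walk⇒simplePath (step adj pw walk) with s ← walk⇒simplePath walk
    with shortcut (path s) (unique s) (pw ∷ inside s)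
  ... | inj₁ a∉s = record
    { path = adj ∷ path s ; unique = a∉s ∷ unique s ; inside = pw ∷ inside s }
  ... | inj₂ s′ = s′

  module _ (C : Cycle G) where
    open Cycle C

    next≡zero⇒last : ∀ m → next m ≡ zero → m ≡ fromℕ _
    next≡zero⇒last m e with view m
    ... | ‵fromℕ   = refl
    ... | ‵inj₁ {i = a} _ with () ← trans (sym (suc-mod-inject₁ a)) e

    edgeOn-0-1 : EdgeOn G (vert zero) (vert (suc zero)) C
    edgeOn-0-1 = zero , inj₁ (refl , cong vert (suc-mod-inject₁ zero))

    edgeOn-0-last : EdgeOn G (vert zero) (vert (fromℕ _)) C
    edgeOn-0-last = fromℕ _ , inj₂ (refl , cong vert (suc-mod-fromℕ _))

    edgeOn-0⇒ : ∀ {x} → EdgeOn G (vert zero) x C → x ≡ vert (suc zero) ⊎ x ≡ vert (fromℕ _)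
    edgeOn-0⇒ (m , inj₁ (m↦0 , next↦x)) with refl ← inj m↦0 =
      inj₁ (trans (sym next↦x) (cong vert (suc-mod-inject₁ zero)))
    edgeOn-0⇒ (m , inj₂ (m↦x , next↦0)) with refl ← next≡zero⇒last m (inj next↦0) =
      inj₂ (sym m↦x)

  toCycle : ∀ {k} (V : Vec (Fin n) (suc (suc (suc k)))) → Unique V →
    (∀ t → Adj (lookup V (inject₁ t)) (lookup V (suc t))) →
    Adj (lookup V (fromℕ _)) (lookup V zero) → Cycle G
  toCycle {k} V u consecutive closing = record
    { k = k ; vert = lookup V ; inj = lookup-injective u _ _ ; closed = closed }
    where
    closed : ∀ m → Adj (lookup V m) (lookup V (suc (toℕ m) mod suc (suc (suc k))))
    closed m with view m
    ... | ‵fromℕ rewrite suc-mod-fromℕ (suc (suc k)) = closing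
    ... | ‵inj₁ {i = a} _ rewrite suc-mod-inject₁ a = consecutive a

  record CycleThrough (i j p : Fin n) : Set where
    field
      cycle  : Cycle G
      edge-j : EdgeOn G i j cycle
      edge-p : EdgeOn G i p cycle
      only   : ∀ {x} → EdgeOn G i x cycle → x ≡ j ⊎ x ≡ p

  closeThrough : ∀ {i j p} → Adj i j → Adj p i → j ≢ i → j ≢ p →
    SimplePathIn (_≢ i) j p → CycleThrough i j p
  closeThrough {i} {j} {p} i~j p~i j≢i j≢p s with vertices s | path s | unique s | inside s
  ... | [] | [] | _ | _ = contradiction refl j≢p
  ... | y ∷ ys | path@(_ ∷ _) | u | inside = record
    { cycle  = C
    ; edge-j = edgeOn-0-1 C
    ; edge-p = subst (λ x → EdgeOn G i x C) last≡p (edgeOn-0-last C)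
    ; only   = λ e → map₂ (λ x≡last → trans x≡last last≡p) (edgeOn-0⇒ C e)
    }
    where
    V : Vec (Fin n) _
    V = i ∷ j ∷ y ∷ ys
    consecutive : ∀ t → Adj (lookup V (inject₁ t)) (lookup V (suc t))
    consecutive zero    = i~j
    consecutive (suc t) = path-adjacent path t
    last≡p : lookup V (fromℕ _) ≡ p
    last≡p = path-last path
    C : Cycle G
    C = toCycle V ((≢-sym j≢i ∷ All.map ≢-sym inside) ∷ u) consecutive
          (subst (λ x → Adj x i) (sym last≡p) p~i)

  cycleThrough-unique : Cactus G → ∀ {i j k p} → Adj i p → j ≢ p →
    CycleThrough i j p → CycleThrough i k p → j ≡ k
  cycleThrough-unique (_ , one-cycle) i~p j≢p C D
    with D.only (Equivalence.to (one-cycle _ _ i~p C.cycle D.cycle C.edge-p D.edge-p _ _) C.edge-j)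
    where
    module C = CycleThrough C
    module D = CycleThrough D
  ... | inj₁ j≡k = j≡k
  ... | inj₂ j≡p = contradiction j≡p j≢p

  parent-unique : ∀ {p q i} → Parent G p i → Parent G q i → p ≡ q
  parent-unique {p} {q} (_ , p~i , before-p) (_ , q~i , before-q) with <-cmp p q
  ... | tri< p<q _ _ = contradiction p~i (before-q p p<q)
  ... | tri≈ _ p≡q _ = p≡q
  ... | tri> _ _ q<p = contradiction q~i (before-p q q<p)

  ∃-parent : ∀ {x i} → x < i → Adj x i → ∃ λ p → Parent G p i × p ≤ x
  ∃-parent {x} {i} x<i x~i with least-witness (λ q → adj? q i) x x~i
  ... | p , p~i , p≤x , before-p = p , (ℕ.≤-<-trans p≤x x<i , p~i , before-p) , p≤x

  prefix-walk : Admissible G → ∀ {i a b : Fin n} → a < i → b < i → WalkIn G (_< i) a b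
  prefix-walk admissible {a = a} {b} a<i b<i with ≤-total a b
  ... | inj₁ a≤b = walk-mono (λ x≤b → ℕ.≤-<-trans x≤b b<i) (admissible b a b a≤b ℕ.≤-refl)
  ... | inj₂ b≤a = walk-mono (λ x≤a → ℕ.≤-<-trans x≤a a<i) (admissible a a b ℕ.≤-refl b≤a)

  -- The first vertex is the parent of each of its neighbours, so it has no cross edge.
  crossEdge⇒parent : Admissible G → ∀ {i j} → CrossEdge G i j → ∃ λ p → Parent G p i
  crossEdge⇒parent _ {zero} {zero} (0~0 , _) = contradiction 0~0 irrefl
  crossEdge⇒parent _ {zero} {suc _} (0~j , not-parent , _) =
    contradiction (z<s , 0~j , λ _ ()) not-parent
  crossEdge⇒parent admissible {suc i} _
    with step i~w w≤i _ ← admissible (suc i) (suc i) zero ℕ.≤-refl z≤n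
    with p , parent , _ ← ∃-parent (≤∧≢⇒< w≤i λ { refl → irrefl i~w }) (adj-sym i~w) =
    p , parent

  crossEdge⇒walk : Admissible G → ∀ {i j p} → Parent G p i → CrossEdge G i j →
    WalkIn G (_< i) j p
  crossEdge⇒walk admissible {i} {j} (p<i , _) (i~j , i-not-parent , _) with <-cmp j i
  ... | tri< j<i _ _ = prefix-walk admissible j<i p<i
  ... | tri≈ _ refl _ = contradiction i~j irrefl
  ... | tri> _ _ i<j with q , q-parent@(_ , q~j , _) , q≤i ← ∃-parent i<j i~j =
    step (adj-sym q~j) q<i (prefix-walk admissible q<i p<i)
    where
    q<i : q < i
    q<i = ≤∧≢⇒< q≤i λ { refl → i-not-parent q-parent }

  crossEdge⇒cycleThrough : Admissible G → ∀ {i j p} → Parent G p i → CrossEdge G i j →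
    CycleThrough i j p
  crossEdge⇒cycleThrough admissible parent@(p<i , p~i , _) cross@(i~j , _ , j-not-parent) =
    closeThrough i~j p~i (λ { refl → irrefl i~j }) (λ { refl → j-not-parent parent })
      (walk⇒simplePath (walk-mono <⇒≢ (crossEdge⇒walk admissible parent cross)))

  crossEdge-unique : Cactus G → Admissible G →
    ∀ i j k → CrossEdge G i j → CrossEdge G i k → j ≡ k
  crossEdge-unique cactus admissible i j k ij@(_ , _ , j-not-parent) ik
    with p , parent@(_ , p~i , _) ← crossEdge⇒parent admissible ij =
    cycleThrough-unique cactus (adj-sym p~i) (λ { refl → j-not-parent parent })
      (crossEdge⇒cycleThrough admissible parent ij)
      (crossEdge⇒cycleThrough admissible parent ik)

  earlier-neighbour⇒parent⊎crossEdge : ∀ {p i x} → Parent G p i → x < i → Adj i x →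
    x ≡ p ⊎ CrossEdge G i x
  earlier-neighbour⇒parent⊎crossEdge {p} {i} {x} parent x<i i~x with x ≟ p
  ... | yes x≡p = inj₁ x≡p
  ... | no x≢p  = inj₂ (i~x , (λ (i<x , _) → ℕ.<-asym x<i i<x)
                            , (λ x-parent → x≢p (parent-unique x-parent parent)))

  at-most-two-earlier-neighbours : Cactus G → Admissible G →
    ∀ i j k l → j < i → k < i → l < i → Adj i j → Adj i k → Adj i l →
    j ≡ k ⊎ j ≡ l ⊎ k ≡ l
  at-most-two-earlier-neighbours cactus admissible i j k l j<i k<i l<i i~j i~k i~l
    with p , parent , _ ← ∃-parent j<i (adj-sym i~j) =
    at-most-two (λ { refl refl → refl }) (crossEdge-unique cactus admissible i _ _)
      (classify j<i i~j) (classify k<i i~k) (classify l<i i~l)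
    where
    classify : ∀ {x} → x < i → Adj i x → x ≡ p ⊎ CrossEdge G i x
    classify = earlier-neighbour⇒parent⊎crossEdge parent

lemma4 : {n : ℕ} (G : Graph n) → Cactus G → Admissible G →
    (∀ (i j k : Fin n) → CrossEdge G i j → CrossEdge G i k → j ≡ k)
    × (∀ (i j k l : Fin n) → j < i → k < i → l < i →
    Graph.Adj G i j → Graph.Adj G i k → Graph.Adj G i l →
    j ≡ k ⊎ j ≡ l ⊎ k ≡ l)
lemma4 G cactus admissible =
  crossEdge-unique G cactus admissible , at-most-two-earlier-neighbours G cactus admissible
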